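{- Let $n\ge3$, $d\ge1$, let $p=[x_1,\dots,x_d]\in[n]^d$, and let $j\in[n]$ be such that $B_j(p)\neq\emptyset$ and, if $n$ is odd, $j\neq\frac{n-1}{2}$. Then the number of lines $\ell$ with $p\in\ell$ that are active in $B_j(p)$ equals $2^{k}-1$, where $k=|B_j(p)|$.
   Context: Let $[n]=\{0,\dots,n-1\}$; the cube $n^d$ is $[n]^d$. A set of $n$ distinct points is a line if it can be ordered $(q^1,\dots,q^n)$ such that in each coordinate the sequence of values is strictly increasing, strictly decreasing or constant, with at least one coordinate non-constant. For $p=[x_1,\dots,x_d]$ and $j\in[n]$, the $j$-block of $p$ is $B_j(p)=\{i\in\{1,\dots,d\}: x_i=j\text{ or }x_i=n-j-1\}$. A line $\ell$ containing $p$ is active in $B_j(p)$ if for some $i\in B_j(p)$ the $i$-th coordinate is not constant along $\ell$. -}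

module Defs where

open import Data.Nat using (ℕ; _∸_)
open import Data.Nat.Properties using (_≟_)
open import Data.Fin using (Fin; toℕ; _<_)
open import Data.List using (List; length; filter; allFin)
open import Data.Product using (Σ; ∃; _×_)
open import Data.Sum using (_⊎_)
open import Relation.Binary.PropositionalEquality using (_≡_; _≢_)
open import Relation.Nullary using (¬_; Dec)
open import Relation.Nullary.Decidable using (_⊎-dec_)

Point : ℕ → ℕ → Set
Point n d = Fin d → Fin n

Seq : ℕ → ℕ → Set
Seq n d = Fin n → Point n d

StrictInc : ∀ {n} → (Fin n → Fin n) → Set
StrictInc f = ∀ s t → s < t → f s < f t

StrictDec : ∀ {n} → (Fin n → Fin n) → Set
StrictDec f = ∀ s t → s < t → f t < f s

Const : ∀ {n} → (Fin n → Fin n) → Set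
Const f = ∀ s t → f s ≡ f t

coord : ∀ {n d} → Seq n d → Fin d → Fin n → Fin n
coord q i t = q t i

Distinct : ∀ {n d} → Seq n d → Set
Distinct {n} {d} q = ∀ s t → s ≢ t → ∃ λ (i : Fin d) → q s i ≢ q t i

-- q is an ordering witnessing that its set of points is a line
IsLine : ∀ {n d} → Seq n d → Set
IsLine {n} {d} q =
  Distinct q ×
  (∀ (i : Fin d) → StrictInc (coord q i) ⊎ StrictDec (coord q i) ⊎ Const (coord q i)) ×
  (∃ λ (i : Fin d) → ¬ Const (coord q i))

_∈ℓ_ : ∀ {n d} → Point n d → Seq n d → Set
_∈ℓ_ {n} {d} x q = ∃ λ (t : Fin n) → ∀ (i : Fin d) → q t i ≡ x i

SameSet : ∀ {n d} → Seq n d → Seq n d → Set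
SameSet {n} {d} q r = ∀ (x : Point n d) → (x ∈ℓ q → x ∈ℓ r) × (x ∈ℓ r → x ∈ℓ q)

InBlock : ∀ {n d} → Fin n → Point n d → Fin d → Set
InBlock {n} j p i = toℕ (p i) ≡ toℕ j ⊎ toℕ (p i) ≡ n ∸ toℕ j ∸ 1

inBlock? : ∀ {n d} (j : Fin n) (p : Point n d) (i : Fin d) → Dec (InBlock j p i)
inBlock? {n} j p i = (toℕ (p i) ≟ toℕ j) ⊎-dec (toℕ (p i) ≟ n ∸ toℕ j ∸ 1)

blockSize : ∀ {n d} → Fin n → Point n d → ℕ
blockSize {n} {d} j p = length (filter (inBlock? j p) (allFin d))

ActiveIn : ∀ {n d} → Fin n → Point n d → Seq n d → Set
ActiveIn {n} {d} j p q = ∃ λ (i : Fin d) → InBlock j p i × ¬ Const (coord q i)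

-- A strictly increasing self-map of [n] is the identity and a strictly decreasing one is
-- the reflection t ↦ n-1-t, so if a line q passes through p at time t₀, every moving
-- coordinate i has p i = t₀ or p i = n-1-t₀.  Activity in B_j(p) then forces
-- t₀ ∈ {j, n-1-j}; after reversing q when t₀ ≠ j, it passes through p at time j, all its
-- moving coordinates lie in B_j(p), and the direction of each is dictated by whether
-- p i = j or p i = n-1-j.  So these lines correspond to the nonempty sets S ⊆ B_j(p) of
-- moving coordinates, and because j ≠ n-1-j different sets S give different lines.
module Submission where

open import Defs
open import Data.Nat as ℕ using (ℕ; suc; _+_; _*_; _∸_; _^_; _%_; _/_; _≥_; z≤n; s≤s)
import Data.Nat.Properties as ℕ
open import Data.Nat.DivMod using ([m+kn]%n≡m%n; m*n/n≡m)
open import Data.Fin as Fin using (Fin; toℕ; opposite; inject₁; fromℕ; _<_)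
open import Data.Fin.Induction using (<-weakInduction; >-weakInduction)
open import Data.Fin.Properties
  using (_≟_; toℕ-injective; toℕ-inject₁; toℕ-fromℕ; toℕ<n; toℕ≤pred[n]; ≤̄⇒inject₁<; opposite-prop; opposite-involutive)
open import Data.List using (List; []; _∷_; _++_; map; length; filter; allFin)
open import Data.List.Properties using (length-++; length-map)
open import Data.List.Membership.Propositional using (_∈_; _∉_)
open import Data.List.Membership.Propositional.Properties using (∈-filter⁺; ∈-filter⁻; ∈-allFin)
open import Data.List.Relation.Binary.Subset.Propositional using (_⊆_)
open import Data.List.Relation.Binary.Subset.Propositional.Properties using (xs⊆x∷xs; ∷⁺ʳ; ⊆-trans; ⊆∷∧∉⇒⊆)
open import Data.List.Relation.Unary.All as All using (All; []; _∷_)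
import Data.List.Relation.Unary.All.Properties as All
open import Data.List.Relation.Unary.Any as Any using (Any; here; there)
import Data.List.Relation.Unary.Any.Properties as Any
open import Data.List.Relation.Unary.AllPairs using (AllPairs; []; _∷_)
import Data.List.Relation.Unary.AllPairs.Properties as AllPairs
open import Data.List.Relation.Unary.Unique.Propositional using (Unique)
open import Data.List.Relation.Unary.Unique.Propositional.Properties using (filter⁺; allFin⁺)
open import Data.Product using (Σ; ∃; _×_; _,_; proj₁; proj₂; uncurry)
open import Data.Sum as Sum using (_⊎_; inj₁; inj₂)
open import Function using (_∘_)
open import Relation.Binary.PropositionalEquality
open import Relation.Nullary using (Dec; yes; no; ¬_; ¬?; contradiction)
open import Relation.Unary using (Decidable)

allPairs-map⁺ : {A B : Set} {P : A → Set} {R : A → A → Set} {R′ : B → B → Set} (f : A → B) →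
  (∀ {a b} → P a → P b → R a b → R′ (f a) (f b)) →
  ∀ {xs} → All P xs → AllPairs R xs → AllPairs R′ (map f xs)
allPairs-map⁺ f h []         []         = []
allPairs-map⁺ f h (pa ∷ pas) (ra ∷ ras) =
  All.map⁺ (All.zipWith (λ (pb , r) → h pa pb r) (pas , ra)) ∷ allPairs-map⁺ f h pas ras

module _ {A : Set} where

  nonemptySublists : List A → List (List A)
  nonemptySublists []       = []
  nonemptySublists (x ∷ xs) = nonemptySublists xs ++ (x ∷ []) ∷ map (x ∷_) (nonemptySublists xs)

  1+length-nonemptySublists : ∀ xs → suc (length (nonemptySublists xs)) ≡ 2 ^ length xs
  1+length-nonemptySublists []       = refl
  1+length-nonemptySublists (x ∷ xs) = begin
    suc (length (ys ++ (x ∷ []) ∷ map (x ∷_) ys))  ≡⟨ cong suc (length-++ ys) ⟩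
    suc (length ys + suc (length (map (x ∷_) ys))) ≡⟨ cong (λ m → suc (length ys + suc m)) (length-map (x ∷_) ys) ⟩
    suc (length ys) + suc (length ys)               ≡⟨ cong (λ m → m + m) (1+length-nonemptySublists xs) ⟩
    2 ^ length xs + 2 ^ length xs                   ≡⟨ cong (2 ^ length xs +_) (sym (ℕ.+-identityʳ _)) ⟩
    2 ^ length (x ∷ xs)                             ∎
    where
    open ≡-Reasoning
    ys = nonemptySublists xs

  length-nonemptySublists : ∀ xs → length (nonemptySublists xs) ≡ 2 ^ length xs ∸ 1
  length-nonemptySublists xs = cong (_∸ 1) (1+length-nonemptySublists xs)

  nonemptySublists-⊆ : ∀ xs → All (_⊆ xs) (nonemptySublists xs)
  nonemptySublists-⊆ []       = []
  nonemptySublists-⊆ (x ∷ xs) = All.++⁺ (All.map weaken IH)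
    ((λ { (here refl) → here refl }) ∷ All.map⁺ (All.map (∷⁺ʳ x) IH))
    where
    IH = nonemptySublists-⊆ xs
    weaken : ∀ {S} → S ⊆ xs → S ⊆ x ∷ xs
    weaken S⊆xs = ⊆-trans S⊆xs (xs⊆x∷xs xs x)

  nonemptySublists-nonempty : ∀ xs → All (λ S → ∃ (_∈ S)) (nonemptySublists xs)
  nonemptySublists-nonempty []       = []
  nonemptySublists-nonempty (x ∷ xs) = All.++⁺ (nonemptySublists-nonempty xs)
    ((x , here refl) ∷ All.map⁺ (All.universal (λ _ → x , here refl) (nonemptySublists xs)))

  nonemptySublists-distinct : ∀ {xs} → Unique xs →
    AllPairs (λ S T → ¬ (S ⊆ T × T ⊆ S)) (nonemptySublists xs)
  nonemptySublists-distinct {[]}     []           = []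
  nonemptySublists-distinct {x ∷ xs} (x≢xs ∷ uniq) = AllPairs.++⁺ (nonemptySublists-distinct uniq)
    (All.map⁺ (All.zipWith singleton≉cons (nonemptySublists-nonempty xs , ⊆xs))
      ∷ allPairs-map⁺ (x ∷_) cons≉cons ⊆xs (nonemptySublists-distinct uniq))
    (All.map (λ S⊆xs → S≉cons S⊆xs ∷ All.map⁺ (All.universal (λ _ → S≉cons S⊆xs) _)) ⊆xs)
    where
    ⊆xs = nonemptySublists-⊆ xs
    x∉xs : x ∉ xs
    x∉xs x∈xs = All.lookup x≢xs x∈xs refl
    singleton≉cons : ∀ {S} → ∃ (_∈ S) × S ⊆ xs → ¬ (x ∷ [] ⊆ x ∷ S × x ∷ S ⊆ x ∷ [])
    singleton≉cons ((y , y∈S) , S⊆xs) (_ , x∷S⊆x) with x∷S⊆x (there y∈S)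
    ... | here refl = x∉xs (S⊆xs y∈S)
    S≉cons : ∀ {S T} → S ⊆ xs → ¬ (S ⊆ x ∷ T × x ∷ T ⊆ S)
    S≉cons S⊆xs (_ , x∷T⊆S) = x∉xs (S⊆xs (x∷T⊆S (here refl)))
    cancel : ∀ {S T} → S ⊆ xs → x ∷ S ⊆ x ∷ T → S ⊆ T
    cancel S⊆xs x∷S⊆x∷T = ⊆∷∧∉⇒⊆ (⊆-trans (xs⊆x∷xs _ x) x∷S⊆x∷T) (λ x∈S → x∉xs (S⊆xs x∈S))
    cons≉cons : ∀ {S T} → S ⊆ xs → T ⊆ xs → ¬ (S ⊆ T × T ⊆ S) → ¬ (x ∷ S ⊆ x ∷ T × x ∷ T ⊆ x ∷ S)
    cons≉cons S⊆xs T⊆xs S≉T (S⊆T , T⊆S) = S≉T (cancel S⊆xs S⊆T , cancel T⊆xs T⊆S)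

  filter-nonemptySublists : {P : A → Set} (P? : Decidable P) (xs : List A) →
    filter P? xs ≡ [] ⊎ filter P? xs ∈ nonemptySublists xs
  filter-nonemptySublists P? []       = inj₁ refl
  filter-nonemptySublists P? (x ∷ xs) with P? x | filter-nonemptySublists P? xs
  ... | no _  | inj₁ ≡[] = inj₁ ≡[]
  ... | no _  | inj₂ ∈ys = inj₂ (Any.++⁺ˡ ∈ys)
  ... | yes _ | inj₁ ≡[] = inj₂ (Any.++⁺ʳ (nonemptySublists xs) (here (cong (x ∷_) ≡[])))
  ... | yes _ | inj₂ ∈ys = inj₂ (Any.++⁺ʳ (nonemptySublists xs) (there (Any.map⁺ (Any.map (cong (x ∷_)) ∈ys))))

  filter∈nonemptySublists : {P : A → Set} (P? : Decidable P) {x : A} {xs : List A} →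
    x ∈ filter P? xs → filter P? xs ∈ nonemptySublists xs
  filter∈nonemptySublists P? {xs = xs} x∈F with filter-nonemptySublists P? xs
  ... | inj₁ F≡[] = contradiction (subst (_ ∈_) F≡[] x∈F) λ ()
  ... | inj₂ F∈   = F∈

module _ {n : ℕ} where

  opposite-injective : ∀ {s t : Fin n} → opposite s ≡ opposite t → s ≡ t
  opposite-injective {s} {t} eq = begin
    s                     ≡⟨ opposite-involutive s ⟨
    opposite (opposite s) ≡⟨ cong opposite eq ⟩
    opposite (opposite t) ≡⟨ opposite-involutive t ⟩
    t                     ∎
    where open ≡-Reasoning

  opposite-< : ∀ {s t : Fin n} → s < t → opposite t < opposite s
  opposite-< {s} {t} s<t rewrite opposite-prop s | opposite-prop t = ℕ.∸-monoʳ-< (s≤s s<t) (toℕ<n t)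

  opposite-strictDec : StrictDec {n} opposite
  opposite-strictDec _ _ = opposite-<

strictInc⇒≗id : ∀ {n} {f : Fin n → Fin n} → StrictInc f → ∀ t → f t ≡ t
strictInc⇒≗id {suc n} {f} inc t = toℕ-injective (ℕ.≤-antisym (below t) (above t))
  where
  inject₁<suc : ∀ i → inject₁ i < Fin.suc i
  inject₁<suc i = ≤̄⇒inject₁< ℕ.≤-refl
  above : ∀ t → toℕ t ℕ.≤ toℕ (f t)
  above = <-weakInduction (λ t → toℕ t ℕ.≤ toℕ (f t)) z≤n λ i ih → begin-strict
    toℕ i                  ≡⟨ toℕ-inject₁ i ⟨
    toℕ (inject₁ i)        ≤⟨ ih ⟩
    toℕ (f (inject₁ i))    <⟨ inc _ _ (inject₁<suc i) ⟩
    toℕ (f (Fin.suc i))    ∎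
    where open ℕ.≤-Reasoning
  below : ∀ t → toℕ (f t) ℕ.≤ toℕ t
  below = >-weakInduction (λ t → toℕ (f t) ℕ.≤ toℕ t)
    (subst₂ ℕ._≤_ refl (sym (toℕ-fromℕ n)) (toℕ≤pred[n] (f (fromℕ n)))) λ i ih → begin
      toℕ (f (inject₁ i))  ≤⟨ ℕ.<⇒≤pred (ℕ.<-≤-trans (inc _ _ (inject₁<suc i)) ih) ⟩
      toℕ i                ≡⟨ toℕ-inject₁ i ⟨
      toℕ (inject₁ i)      ∎
    where open ℕ.≤-Reasoning

strictDec⇒≗opposite : ∀ {n} {f : Fin n → Fin n} → StrictDec f → ∀ t → f t ≡ opposite t
strictDec⇒≗opposite {f = f} dec t = opposite-injective (begin
  opposite (f t)         ≡⟨ strictInc⇒≗id (λ s u s<u → opposite-< (dec s u s<u)) t ⟩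
  t                      ≡⟨ opposite-involutive t ⟨
  opposite (opposite t)  ∎)
  where open ≡-Reasoning

strictInc⇒injective : ∀ {n} {f : Fin n → Fin n} → StrictInc f → ∀ {s t} → f s ≡ f t → s ≡ t
strictInc⇒injective inc {s} {t} eq = trans (sym (strictInc⇒≗id inc s)) (trans eq (strictInc⇒≗id inc t))

strictDec⇒injective : ∀ {n} {f : Fin n → Fin n} → StrictDec f → ∀ {s t} → f s ≡ f t → s ≡ t
strictDec⇒injective dec {s} {t} eq =
  opposite-injective (trans (sym (strictDec⇒≗opposite dec s)) (trans eq (strictDec⇒≗opposite dec t)))

Admissible : ∀ {n} → (Fin n → Fin n) → Set
Admissible f = StrictInc f ⊎ StrictDec f ⊎ Const f

toℕ-opposite : ∀ {n} (t : Fin n) → toℕ (opposite t) ≡ n ∸ toℕ t ∸ 1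
toℕ-opposite {n} t = begin
  toℕ (opposite t)    ≡⟨ opposite-prop t ⟩
  n ∸ suc (toℕ t)     ≡⟨ cong (n ∸_) (ℕ.+-comm 1 (toℕ t)) ⟩
  n ∸ (toℕ t + 1)   ≡⟨ ℕ.∸-+-assoc n (toℕ t) 1 ⟨
  n ∸ toℕ t ∸ 1       ∎
  where open ≡-Reasoning

fixed-opposite⇒middle : ∀ {n} (j : Fin n) → j ≡ opposite j → n % 2 ≡ 1 × toℕ j ≡ (n ∸ 1) / 2
fixed-opposite⇒middle {n} j j≡j′ =
  trans (cong (_% 2) n≡1+2j) ([m+kn]%n≡m%n 1 (toℕ j) 2) ,
  sym (trans (cong (λ m → (m ∸ 1) / 2) n≡1+2j) (m*n/n≡m (toℕ j) 2))
  where
  open ≡-Reasoning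
  n≡1+2j : n ≡ 1 + toℕ j * 2
  n≡1+2j = begin
    n                           ≡⟨ ℕ.m∸n+n≡m (toℕ<n j) ⟨
    n ∸ suc (toℕ j) + suc (toℕ j) ≡⟨ cong (_+ suc (toℕ j)) (trans (sym (opposite-prop j)) (cong toℕ (sym j≡j′))) ⟩
    toℕ j + suc (toℕ j)         ≡⟨ ℕ.+-suc (toℕ j) (toℕ j) ⟩
    suc (toℕ j + toℕ j)         ≡⟨ cong (λ m → suc (toℕ j + m)) (ℕ.+-identityʳ (toℕ j)) ⟨
    suc (toℕ j + (toℕ j + 0))   ≡⟨ cong suc (ℕ.*-comm 2 (toℕ j)) ⟩
    1 + toℕ j * 2               ∎

sameSet-reindex : ∀ {n d} {q r : Seq n d} (σ : Fin n → Fin n) → (∀ t → σ (σ t) ≡ t) →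
  (∀ t i → q (σ t) i ≡ r t i) → SameSet q r
sameSet-reindex {q = q} {r} σ σ-involutive q∘σ≡r x =
  (λ (t , q[t]≡x) → σ t , λ i → begin
    r (σ t) i      ≡⟨ q∘σ≡r (σ t) i ⟨
    q (σ (σ t)) i  ≡⟨ cong (λ s → q s i) (σ-involutive t) ⟩
    q t i          ≡⟨ q[t]≡x i ⟩
    x i            ∎) ,
  (λ (t , r[t]≡x) → σ t , λ i → trans (q∘σ≡r t i) (r[t]≡x i))
  where open ≡-Reasoning

module Construction {n d : ℕ} (p : Point n d) (j : Fin n) (j≢j′ : j ≢ opposite j) where

  open import Data.List.Membership.DecPropositional (_≟_ {d}) using (_∈?_)

  BlockValue : Fin n → Set
  BlockValue x = x ≡ j ⊎ x ≡ opposite j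

  inBlock⇒blockValue : ∀ {i} → InBlock j p i → BlockValue (p i)
  inBlock⇒blockValue = Sum.map toℕ-injective (λ eq → toℕ-injective (trans eq (sym (toℕ-opposite j))))

  blockValue⇒inBlock : ∀ {i} → BlockValue (p i) → InBlock j p i
  blockValue⇒inBlock = Sum.map (cong toℕ) (λ eq → trans (cong toℕ eq) (toℕ-opposite j))

  blockValue-opposite : ∀ {x} → BlockValue x → BlockValue (opposite x)
  blockValue-opposite (inj₁ refl) = inj₂ refl
  blockValue-opposite (inj₂ refl) = inj₁ (opposite-involutive j)

  -- The motion of a coordinate that has to take the value x at time j.
  orient : Fin n → Fin n → Fin n
  orient x t with x ≟ j
  ... | yes _ = t
  ... | no _  = opposite t

  orient-j : ∀ {x} → BlockValue x → orient x j ≡ x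
  orient-j {x} x∈B with x ≟ j | x∈B
  ... | yes x≡j | _          = sym x≡j
  ... | no x≢j  | inj₁ x≡j   = contradiction x≡j x≢j
  ... | no _    | inj₂ x≡j′  = sym x≡j′

  orient-injective : ∀ x {s t} → orient x s ≡ orient x t → s ≡ t
  orient-injective x eq with x ≟ j
  ... | yes _ = eq
  ... | no _  = opposite-injective eq

  orient-involutive : ∀ x t → orient x (orient x t) ≡ t
  orient-involutive x t with x ≟ j
  ... | yes _ = refl
  ... | no _  = opposite-involutive t

  orient-admissible : ∀ x → Admissible (orient x)
  orient-admissible x with x ≟ j
  ... | yes _ = inj₁ λ _ _ s<t → s<t
  ... | no _  = inj₂ (inj₁ opposite-strictDec)

  orient-opposite : ∀ {x} → BlockValue x → ∀ t → orient (opposite x) t ≡ opposite (orient x t)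
  orient-opposite {x} x∈B t with x ≟ j | opposite x ≟ j | x∈B
  ... | yes refl | yes j′≡j | _         = contradiction (sym j′≡j) j≢j′
  ... | yes _    | no _     | _         = refl
  ... | no _     | yes _    | _         = sym (opposite-involutive t)
  ... | no x≢j   | no _     | inj₁ x≡j  = contradiction x≡j x≢j
  ... | no _     | no x′≢j  | inj₂ refl = contradiction (opposite-involutive j) x′≢j

  line : List (Fin d) → Seq n d
  line S t i with i ∈? S
  ... | yes _ = orient (p i) t
  ... | no _  = p i

  line-∈ : ∀ {S i} t → i ∈ S → line S t i ≡ orient (p i) t
  line-∈ {S} {i} t i∈S with i ∈? S
  ... | yes _   = refl
  ... | no i∉S  = contradiction i∈S i∉S

  line-∉ : ∀ {S i} t → i ∉ S → line S t i ≡ p i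
  line-∉ {S} {i} t i∉S with i ∈? S
  ... | yes i∈S = contradiction i∈S i∉S
  ... | no _    = refl

  line-admissible : ∀ S i → Admissible (coord (line S) i)
  line-admissible S i with i ∈? S
  ... | yes _ = orient-admissible (p i)
  ... | no _  = inj₂ (inj₂ λ _ _ → refl)

  block : List (Fin d)
  block = filter (inBlock? j p) (allFin d)

  ∈block⇒inBlock : ∀ {i} → i ∈ block → InBlock j p i
  ∈block⇒inBlock i∈B = proj₂ (∈-filter⁻ (inBlock? j p) {xs = allFin d} i∈B)

  ∈block⇒blockValue : ∀ {i} → i ∈ block → BlockValue (p i)
  ∈block⇒blockValue = inBlock⇒blockValue ∘ ∈block⇒inBlock

  blockValue⇒∈block : ∀ {i} → BlockValue (p i) → i ∈ block
  blockValue⇒∈block {i} pᵢ∈B = ∈-filter⁺ (inBlock? j p) (∈-allFin i) (blockValue⇒inBlock pᵢ∈B)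

  module _ {S} (S⊆B : S ⊆ block) where

    line-∋p : p ∈ℓ line S
    line-∋p = j , line[j]≡p
      where
      line[j]≡p : ∀ i → line S j i ≡ p i
      line[j]≡p i with i ∈? S
      ... | yes i∈S = orient-j (∈block⇒blockValue (S⊆B i∈S))
      ... | no _    = refl

    module _ {i₀} (i₀∈S : i₀ ∈ S) where

      line-injective-at : ∀ {s t} → line S s i₀ ≡ line S t i₀ → s ≡ t
      line-injective-at {s} {t} eq =
        orient-injective (p i₀) (trans (sym (line-∈ s i₀∈S)) (trans eq (line-∈ t i₀∈S)))

      line-nonconst : ¬ Const (coord (line S) i₀)
      line-nonconst const = j≢j′ (line-injective-at (const j (opposite j)))

      line-isLine : IsLine (line S)
      line-isLine = (λ _ _ s≢t → i₀ , s≢t ∘ line-injective-at) , line-admissible S , (i₀ , line-nonconst)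

      line-active : ActiveIn j p (line S)
      line-active = i₀ , ∈block⇒inBlock (S⊆B i₀∈S) , line-nonconst

    line-⊆⇒⊆ : ∀ {T} → (∀ x → x ∈ℓ line S → x ∈ℓ line T) → S ⊆ T
    line-⊆⇒⊆ {T} line[S]⊆line[T] {i} i∈S with i ∈? T
    ... | yes i∈T = i∈T
    ... | no i∉T  = contradiction (orient-injective (p i) (begin
        orient (p i) j            ≡⟨ orient-j (∈block⇒blockValue (S⊆B i∈S)) ⟩
        p i                       ≡⟨ line-∉ t i∉T ⟨
        line T t i                ≡⟨ line[T][t]≡x i ⟩
        line S (opposite j) i     ≡⟨ line-∈ (opposite j) i∈S ⟩
        orient (p i) (opposite j) ∎)) j≢j′
      where
      open ≡-Reasoning
      witness = line[S]⊆line[T] (line S (opposite j)) (opposite j , λ _ → refl)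
      t = proj₁ witness
      line[T][t]≡x = proj₂ witness

  line-≉ : ∀ {S T} → S ⊆ block → T ⊆ block → ¬ (S ⊆ T × T ⊆ S) → ¬ SameSet (line S) (line T)
  line-≉ S⊆B T⊆B S≉T same = S≉T (line-⊆⇒⊆ S⊆B (proj₁ ∘ same) , line-⊆⇒⊆ T⊆B (proj₂ ∘ same))

  module Normalise {q : Seq n d} (q-admissible : ∀ i → Admissible (coord q i))
                   {t₀ : Fin n} (q[t₀]≡p : ∀ i → q t₀ i ≡ p i) where

    moves? : ∀ i → Dec (q j i ≢ q (opposite j) i)
    moves? i = ¬? (q j i ≟ q (opposite j) i)

    moving : List (Fin d)
    moving = filter moves? block

    increasing⇒p≡t₀ : ∀ {i} → StrictInc (coord q i) → p i ≡ t₀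
    increasing⇒p≡t₀ {i} inc = trans (sym (q[t₀]≡p i)) (strictInc⇒≗id inc t₀)

    decreasing⇒p≡t₀′ : ∀ {i} → StrictDec (coord q i) → p i ≡ opposite t₀
    decreasing⇒p≡t₀′ {i} dec = trans (sym (q[t₀]≡p i)) (strictDec⇒≗opposite dec t₀)

    increasing⇒∈moving : ∀ {i} → StrictInc (coord q i) → BlockValue t₀ → i ∈ moving
    increasing⇒∈moving {i} inc t₀∈B =
      ∈-filter⁺ _ (blockValue⇒∈block (subst BlockValue (sym (increasing⇒p≡t₀ inc)) t₀∈B))
        (j≢j′ ∘ strictInc⇒injective inc)

    decreasing⇒∈moving : ∀ {i} → StrictDec (coord q i) → BlockValue t₀ → i ∈ moving
    decreasing⇒∈moving {i} dec t₀∈B =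
      ∈-filter⁺ _ (blockValue⇒∈block (subst BlockValue (sym (decreasing⇒p≡t₀′ dec)) (blockValue-opposite t₀∈B)))
        (j≢j′ ∘ strictDec⇒injective dec)

    constant⇒∉moving : ∀ {i} → Const (coord q i) → i ∉ moving
    constant⇒∉moving const i∈S = proj₂ (∈-filter⁻ _ {xs = block} i∈S) (const j (opposite j))

    nonconst⇒t₀∈B : ∀ {i} → BlockValue (p i) → ¬ Const (coord q i) → BlockValue t₀
    nonconst⇒t₀∈B {i} pᵢ∈B nonconst with q-admissible i
    ... | inj₁ inc         = subst BlockValue (increasing⇒p≡t₀ inc) pᵢ∈B
    ... | inj₂ (inj₁ dec)  = subst BlockValue (opposite-involutive t₀)
                               (blockValue-opposite (subst BlockValue (decreasing⇒p≡t₀′ dec) pᵢ∈B))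
    ... | inj₂ (inj₂ const) = contradiction const nonconst

    -- orient t₀ reverses q unless t₀ = j, so that it passes through p at time j.
    q∘orient≡line : BlockValue t₀ → ∀ t i → q (orient t₀ t) i ≡ line moving t i
    q∘orient≡line t₀∈B t i with q-admissible i
    ... | inj₁ inc = begin
      q (orient t₀ t) i  ≡⟨ strictInc⇒≗id inc _ ⟩
      orient t₀ t        ≡⟨ cong (λ x → orient x t) (increasing⇒p≡t₀ inc) ⟨
      orient (p i) t     ≡⟨ line-∈ t (increasing⇒∈moving inc t₀∈B) ⟨
      line moving t i    ∎
      where open ≡-Reasoning
    ... | inj₂ (inj₁ dec) = begin
      q (orient t₀ t) i          ≡⟨ strictDec⇒≗opposite dec _ ⟩
      opposite (orient t₀ t)     ≡⟨ orient-opposite t₀∈B t ⟨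
      orient (opposite t₀) t     ≡⟨ cong (λ x → orient x t) (decreasing⇒p≡t₀′ dec) ⟨
      orient (p i) t             ≡⟨ line-∈ t (decreasing⇒∈moving dec t₀∈B) ⟨
      line moving t i            ∎
      where open ≡-Reasoning
    ... | inj₂ (inj₂ const) = begin
      q (orient t₀ t) i  ≡⟨ const _ t₀ ⟩
      q t₀ i             ≡⟨ q[t₀]≡p i ⟩
      p i                ≡⟨ line-∉ t (constant⇒∉moving const) ⟨
      line moving t i    ∎
      where open ≡-Reasoning

    nonconst⇒∈moving : ∀ {i} → BlockValue t₀ → ¬ Const (coord q i) → i ∈ moving
    nonconst⇒∈moving {i} t₀∈B nonconst with q-admissible i
    ... | inj₁ inc          = increasing⇒∈moving inc t₀∈B
    ... | inj₂ (inj₁ dec)   = decreasing⇒∈moving dec t₀∈B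
    ... | inj₂ (inj₂ const) = contradiction const nonconst

  lines : List (Seq n d)
  lines = map line (nonemptySublists block)

  length-lines : length lines ≡ 2 ^ blockSize j p ∸ 1
  length-lines = trans (length-map line (nonemptySublists block)) (length-nonemptySublists block)

  lines-sound : All (λ q → IsLine q × p ∈ℓ q × ActiveIn j p q) lines
  lines-sound = All.map⁺ (All.zipWith
    (λ (S⊆B , _ , i₀∈S) → line-isLine S⊆B i₀∈S , line-∋p S⊆B , line-active S⊆B i₀∈S)
    (nonemptySublists-⊆ block , nonemptySublists-nonempty block))

  lines-distinct : AllPairs (λ q r → ¬ SameSet q r) lines
  lines-distinct = allPairs-map⁺ line line-≉ (nonemptySublists-⊆ block)
    (nonemptySublists-distinct (filter⁺ (inBlock? j p) (allFin⁺ d)))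

  lines-complete : ∀ q → IsLine q → p ∈ℓ q → ActiveIn j p q → Any (SameSet q) lines
  lines-complete q (_ , q-admissible , _) (t₀ , q[t₀]≡p) (i₀ , i₀∈B , i₀-nonconst) =
    Any.map⁺ (Any.map (λ { refl → q≈line[moving] }) (filter∈nonemptySublists moves? {xs = block} i₀∈moving))
    where
    open Normalise q-admissible q[t₀]≡p
    t₀∈B : BlockValue t₀
    t₀∈B = nonconst⇒t₀∈B (inBlock⇒blockValue i₀∈B) i₀-nonconst
    i₀∈moving : i₀ ∈ moving
    i₀∈moving = nonconst⇒∈moving t₀∈B i₀-nonconst
    q≈line[moving] : SameSet q (line moving)
    q≈line[moving] = sameSet-reindex (orient t₀) (orient-involutive t₀) (q∘orient≡line t₀∈B)

lemma13 : (n d : ℕ) → n ≥ 3 → d ≥ 1 → (p : Point n d) → (j : Fin n) →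
    (∃ λ (i : Fin d) → InBlock j p i) →
    (n % 2 ≡ 1 → toℕ j ≢ (n ∸ 1) / 2) →
    Σ (List (Seq n d)) λ L →
      length L ≡ 2 ^ blockSize j p ∸ 1 ×
      All (λ q → IsLine q × p ∈ℓ q × ActiveIn j p q) L ×
      AllPairs (λ q r → ¬ SameSet q r) L ×
      (∀ (q : Seq n d) → IsLine q → p ∈ℓ q → ActiveIn j p q → Any (SameSet q) L)
lemma13 n d _ _ p j _ j≢middle = lines , length-lines , lines-sound , lines-distinct , lines-complete
  where
  open Construction p j (uncurry j≢middle ∘ fixed-opposite⇒middle j)
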